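{- Let $i\ge i'\ge -1$ and $j\ge j'$ with $j,j'\in\{ -1,\dots,n-1\}$. If $$\mathrm{ED}(j',i')>\mathrm{ED}(j,i')-(j-j')+2(i-i'),$$ then no smallest-weight path from $(-1,-1)$ to $(j,i)$ in the DAG passes through the node $(j',i')$.
   Context: Let $F$ be a string of length $n$ and let $S=S[0]S[1]\cdots$ be a (stream) string over the same alphabet. The DAG has nodes $(j,i)$ with row $j\in\{ -1,0,\dots,n-1\}$ and column $i\in\{ -1,0,1,\dots\}$. Each node $(j,i)$ has the following outgoing edges: - a horizontal edge to $(j,i+1)$, of weight $1$ except weight $0$ when $j=-1$; - when $j\le n-2$, a vertical edge to $(j+1,i)$ of weight $1$; - when $j\le n-2$, a diagonal edge to $(j+1,i+1)$ of weight $0$ if $F[j+1]=S[i+1]$ and weight $1$ otherwise. $\mathrm{ED}(j,i)$ is the minimum weight of a directed path from $(-1,-1)$ to $(j,i)$. -}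

module Defs where

open import Data.Nat using (ℕ; zero; suc; _+_; _≤_; _<_)
open import Data.Fin using (Fin; fromℕ<)
open import Data.Vec using (Vec; lookup)
open import Data.List using (List; []; _∷_)
open import Data.Product using (_×_; _,_; Σ)
open import Data.List.Membership.Propositional using (_∈_)
open import Relation.Binary.Definitions using (DecidableEquality)
open import Relation.Nullary using (yes; no)
open import Relation.Binary.PropositionalEquality using (_≡_)

-- Coordinates are shifted by one: the paper's node (j , i), with
-- j ∈ {-1,…,n-1} and i ∈ {-1,0,1,…}, is represented here by (r , c)
-- with r = j + 1 ∈ {0,…,n} and c = i + 1 ∈ ℕ.  The source (-1,-1) is (0,0).
-- The pattern F is a vector of length n, the stream S is a function ℕ → A;
-- the paper's F[j+1] is  lookup F r  and S[i+1] is  S c.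

-- Vertical / diagonal edges leave (r,c) only when j ≤ n-2, i.e. r < n.
data Path {A : Set} {n : ℕ} (F : Vec A n) (S : ℕ → A) : ℕ → ℕ → Set where
  start : Path F S 0 0
  horiz : ∀ {r c} → Path F S r c → Path F S r (suc c)
  vert  : ∀ {r c} → r < n → Path F S r c → Path F S (suc r) c
  diag  : ∀ {r c} → r < n → Path F S r c → Path F S (suc r) (suc c)

module _ {A : Set} (_≟_ : DecidableEquality A) {n : ℕ} {F : Vec A n} {S : ℕ → A} where

  diagWeight : (r c : ℕ) → r < n → ℕ
  diagWeight r c r<n with lookup F (fromℕ< r<n) ≟ S c
  ... | yes _ = 0
  ... | no  _ = 1

  horizWeight : ℕ → ℕ
  horizWeight zero    = 0
  horizWeight (suc _) = 1

  weight : ∀ {r c} → Path F S r c → ℕ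
  weight start                     = 0
  weight (horiz {r} p)             = weight p + horizWeight r
  weight (vert _ p)                = weight p + 1
  weight (diag {r} {c} r<n p)      = weight p + diagWeight r c r<n

  IsED : ℕ → ℕ → ℕ → Set
  IsED r c d = Σ (Path F S r c) (λ p → weight p ≡ d) × (∀ (q : Path F S r c) → d ≤ weight q)

  Smallest : ∀ {r c} → Path F S r c → Set
  Smallest {r} {c} p = ∀ (q : Path F S r c) → weight p ≤ weight q

nodes : ∀ {A : Set} {n : ℕ} {F : Vec A n} {S : ℕ → A} {r c} → Path F S r c → List (ℕ × ℕ)
nodes start                 = (0 , 0) ∷ []
nodes (horiz {r} {c} p)     = (r , suc c) ∷ nodes p
nodes (vert {r} {c} _ p)    = (suc r , c) ∷ nodes p
nodes (diag {r} {c} _ p)    = (suc r , suc c) ∷ nodes p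

PassesThrough : ∀ {A : Set} {n : ℕ} {F : Vec A n} {S : ℕ → A} {r c} → Path F S r c → ℕ → ℕ → Set
PassesThrough p r' c' = (r' , c') ∈ nodes p

module Submission where

-- Write m = r - r' and k = c - c' (rows and columns shifted by one as
-- in Defs), and let p be a smallest-weight path to (r , c) through (r' , c').
--   * Upper bound: an optimal path to (r , c') followed by k horizontal edges
--     (each of weight ≤ 1) reaches (r , c), so  weight p ≤ d + k.
--   * Lower bound: cut p at (r' , c').  The prefix weighs at least d', and the
--     suffix climbs m rows using at most k diagonal edges, so it contains at
--     least m - k vertical edges of weight 1:  d' + m ≤ weight p + k.
-- Together  d' + m ≤ d + 2k, i.e.  d' ≤ d - m + 2k, contradicting the
-- hypothesis.

open import Defs
open import Data.Nat using (ℕ; _≤_)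
open import Data.Nat as N using ()
open import Data.Integer using (+_; _-_; _*_) renaming (_+_ to _+ℤ_; _>_ to _>ℤ_)
open import Data.Vec using (Vec)
open import Relation.Binary.Definitions using (DecidableEquality)
open import Relation.Nullary using (¬_)

open import Data.Nat using (zero; suc; _+_; _∸_; z≤n; s≤s)
open import Data.Nat.Properties
  using ( ≤-trans; ≤-reflexive; +-mono-≤; +-monoˡ-≤; +-cancelʳ-≤
        ; m≤m+n; n≤1+n; m∸n+n≡m; +-identityʳ; <⇒≱; module ≤-Reasoning )
import Data.Nat.Tactic.RingSolver as ℕSolver
import Data.Integer as ℤ
import Data.Integer.Properties as ℤ
import Data.Integer.Tactic.RingSolver as ℤSolver
open import Data.Product using (Σ; _,_)
open import Data.List.Relation.Unary.Any using (here; there)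
open import Relation.Binary.PropositionalEquality using (_≡_; refl; sym; trans; cong; subst; subst₂)

module PathBounds {A : Set} (_≟_ : DecidableEquality A) {n : ℕ} {F : Vec A n} {S : ℕ → A} where

  wt : ∀ {r c} → Path F S r c → ℕ
  wt = weight _≟_ {n} {F} {S}

  sucMiddle : ∀ a b d → a + suc b + d ≡ suc (a + b + d)
  sucMiddle = ℕSolver.solve-∀

  swapLast : ∀ a b d → a + b + d ≡ a + d + b
  swapLast = ℕSolver.solve-∀

  horizWeight≤1 : ∀ r → horizWeight _≟_ {n} {F} {S} r ≤ 1
  horizWeight≤1 zero    = z≤n
  horizWeight≤1 (suc r) = s≤s z≤n

  extendRight : ∀ {r c} (k : ℕ) (p : Path F S r c) →
                Σ (Path F S r (k + c)) λ q → wt q ≤ wt p + k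
  extendRight zero    p = p , ≤-reflexive (sym (+-identityʳ (wt p)))
  extendRight {r} (suc k) p with extendRight k p
  ... | q , q≤ = horiz q , (begin
      wt q + horizWeight _≟_ {n} {F} {S} r ≤⟨ +-mono-≤ q≤ (horizWeight≤1 r) ⟩
      wt p + k + 1                          ≡⟨ sucLast (wt p) k ⟩
      wt p + suc k                          ∎)
    where
    open ≤-Reasoning
    sucLast : ∀ a b → a + b + 1 ≡ a + suc b
    sucLast = ℕSolver.solve-∀

  extendTo : ∀ {r c' c} → c' ≤ c → (p : Path F S r c') →
             Σ (Path F S r c) λ q → wt q ≤ wt p + (c ∸ c')
  extendTo {r} {c'} {c} c'≤c p =
    subst (λ x → Σ (Path F S r x) λ q → wt q ≤ wt p + (c ∸ c'))
          (m∸n+n≡m c'≤c) (extendRight (c ∸ c') p)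

  smallestBound : ∀ {r c' c d} → c' ≤ c → IsED _≟_ {n} {F} {S} r c' d →
                  (p : Path F S r c) → Smallest _≟_ p → wt p ≤ d + (c ∸ c')
  smallestBound {c' = c'} {c} c'≤c ((p₀ , refl) , _) p smallest
    with extendTo c'≤c p₀
  ... | q , q≤ = ≤-trans (smallest q) q≤

  -- Along any path the quantity  weight + column - row  never decreases
  -- (horizontal: +1 column; vertical: +1 weight, +1 row; diagonal: +1 row,
  -- +1 column).  Hence a prefix q of p ending at (r' , c') satisfies
  -- wt q + (r - r') ≤ wt p + (c - c'), stated below without subtraction.
  whole : ∀ {r c} (p : Path F S r c) → Σ (Path F S r c) λ q → wt q + r + c ≤ wt p + c + r
  whole {r} {c} p = p , ≤-reflexive (swapLast (wt p) r c)

  prefixAt : ∀ {r c r' c'} (p : Path F S r c) → PassesThrough p r' c' →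
             Σ (Path F S r' c') λ q → wt q + r + c' ≤ wt p + c + r'
  prefixAt p@start      (here refl) = whole p
  prefixAt p@(horiz _)  (here refl) = whole p
  prefixAt p@(vert _ _) (here refl) = whole p
  prefixAt p@(diag _ _) (here refl) = whole p
  prefixAt {r' = r'} {c'} (horiz {r} {c} p) (there visits) with prefixAt p visits
  ... | q , q≤ = q , (begin
      wt q + r + c'                                ≤⟨ q≤ ⟩
      wt p + c + r'                                ≤⟨ +-monoˡ-≤ r' (+-mono-≤ (m≤m+n _ _) (n≤1+n c)) ⟩
      wt p + horizWeight _≟_ {n} {F} {S} r + suc c + r' ∎)
    where open ≤-Reasoning
  prefixAt {r' = r'} {c'} (vert {r} {c} _ p) (there visits) with prefixAt p visits
  ... | q , q≤ = q , (begin
      wt q + suc r + c'      ≡⟨ sucMiddle (wt q) r c' ⟩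
      suc (wt q + r + c')    ≤⟨ s≤s q≤ ⟩
      suc (wt p + c + r')    ≡⟨ sucFirst (wt p) c r' ⟩
      wt p + 1 + c + r'      ∎)
    where
    open ≤-Reasoning
    sucFirst : ∀ a b d → suc (a + b + d) ≡ a + 1 + b + d
    sucFirst = ℕSolver.solve-∀
  prefixAt {r' = r'} {c'} (diag {r} {c} r<n p) (there visits) with prefixAt p visits
  ... | q , q≤ = q , (begin
      wt q + suc r + c'                          ≡⟨ sucMiddle (wt q) r c' ⟩
      suc (wt q + r + c')                        ≤⟨ s≤s q≤ ⟩
      suc (wt p + c + r')                        ≡⟨ sym (sucMiddle (wt p) c r') ⟩
      wt p + suc c + r'                          ≤⟨ +-monoˡ-≤ r' (+-monoˡ-≤ (suc c) (m≤m+n _ _)) ⟩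
      wt p + diagWeight _≟_ r c r<n + suc c + r' ∎)
    where open ≤-Reasoning

open PathBounds

offsetsToDifferences : ∀ {a b r r' c c'} → r' ≤ r → c' ≤ c →
                       a + r + c' ≤ b + c + r' → a + (r ∸ r') ≤ b + (c ∸ c')
offsetsToDifferences {a} {b} {r} {r'} {c} {c'} r'≤r c'≤c le =
  +-cancelʳ-≤ (r' + c') (a + (r ∸ r')) (b + (c ∸ c')) (begin
    a + (r ∸ r') + (r' + c')   ≡⟨ regroupˡ a (r ∸ r') r' c' ⟩
    a + (r ∸ r' + r') + c'     ≡⟨ cong (λ x → a + x + c') (m∸n+n≡m r'≤r) ⟩
    a + r + c'                 ≤⟨ le ⟩
    b + c + r'                 ≡⟨ cong (λ x → b + x + r') (sym (m∸n+n≡m c'≤c)) ⟩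
    b + (c ∸ c' + c') + r'     ≡⟨ regroupʳ b (c ∸ c') r' c' ⟩
    b + (c ∸ c') + (r' + c')   ∎)
  where
  open ≤-Reasoning
  regroupˡ : ∀ x y u v → x + y + (u + v) ≡ x + (y + u) + v
  regroupˡ = ℕSolver.solve-∀
  regroupʳ : ∀ x y u v → x + (y + v) + u ≡ x + y + (u + v)
  regroupʳ = ℕSolver.solve-∀

integerGap : ∀ d' d m k → d' + m ≤ d + 2 N.* k →
             ¬ ((+ d') >ℤ ((+ d) - (+ m)) +ℤ (+ 2) * (+ k))
integerGap d' d m k le gt = <⇒≱ (ℤ.drop‿+<+ shifted) le
  where
  cancel : ∀ (x y z : ℤ.ℤ) → (x - y) +ℤ z +ℤ y ≡ x +ℤ z
  cancel = ℤSolver.solve-∀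
  shifted : (+ (d + 2 N.* k)) ℤ.< (+ (d' + m))
  shifted = subst₂ ℤ._<_
    (trans (cancel (+ d) (+ m) ((+ 2) * (+ k)))
           (trans (cong ((+ d) +ℤ_) (sym (ℤ.pos-* 2 k))) (sym (ℤ.pos-+ d (2 N.* k)))))
    (sym (ℤ.pos-+ d' m))
    (ℤ.+-monoˡ-< (+ m) gt)

lemma14 : {A : Set} (_≟_ : DecidableEquality A) {n : ℕ} (F : Vec A n) (S : ℕ → A)
    (r c r' c' : ℕ) → c' ≤ c → r' ≤ r → r ≤ n →
    (d' d : ℕ) → IsED _≟_ {n} {F} {S} r' c' d' → IsED _≟_ {n} {F} {S} r c' d →
    (+ d') >ℤ ((+ d) - (+ (r N.∸ r'))) +ℤ (+ 2) * (+ (c N.∸ c')) →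
    (p : Path F S r c) → Smallest _≟_ p → ¬ PassesThrough p r' c'
lemma14 _≟_ F S r c r' c' c'≤c r'≤r _ d' d (_ , edMinimal) ed gt p smallest visits
  with prefixAt _≟_ p visits
... | q , q≤ = integerGap d' d (r ∸ r') (c ∸ c') detourBound gt
  where
  open ≤-Reasoning
  addTwice : ∀ x y → x + y + y ≡ x + 2 N.* y
  addTwice = ℕSolver.solve-∀
  detourBound : d' + (r ∸ r') ≤ d + 2 N.* (c ∸ c')
  detourBound = begin
    d' + (r ∸ r')                 ≤⟨ +-monoˡ-≤ (r ∸ r') (edMinimal q) ⟩
    wt _≟_ q + (r ∸ r')           ≤⟨ offsetsToDifferences r'≤r c'≤c q≤ ⟩
    wt _≟_ p + (c ∸ c')           ≤⟨ +-monoˡ-≤ (c ∸ c') (smallestBound _≟_ c'≤c ed p smallest) ⟩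
    d + (c ∸ c') + (c ∸ c')       ≡⟨ addTwice d (c ∸ c') ⟩
    d + 2 N.* (c ∸ c')            ∎
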